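{- Let $n=p'q$ where $p',q$ are distinct primes, both at least $7$, and let $A=L(n;p')$. Let $S=(x_1,x_2,x_3)$ be an $A$-extremal sequence for the Davenport constant in $\mathbb{Z}_n$. Then $S$ is equivalent with respect to $A$ to a sequence $(y_1,y_2,y_3)$ for which one of the following holds: (i) $y_1$ is the only term divisible by $q$, $y_1\neq 0$, and the image of $(y_2,y_3)$ under the natural map $\mathbb{Z}_n\to\mathbb{Z}_q$ is a $Q_q$-extremal sequence for the Davenport constant; (ii) $y_1$ is the only term coprime to $p'$, and the image of $(y_2,y_3)$ under the natural map $\mathbb{Z}_n\to\mathbb{Z}_q$ is a $Q_q$-extremal sequence for the Davenport constant.
   Context: For $m\geq 2$, $\mathbb{Z}_m=\mathbb{Z}/m\mathbb{Z}$, $U(m)$ its unit group; for $d\mid m$ the natural map $\mathbb{Z}_m\to\mathbb{Z}_d$ is reduction mod $d$. For an odd prime $q$, $Q_q=\{x^2: x\in U(q)\}$. For nonempty $A\subseteq\mathbb{Z}_m\setminus\{0\}$, a sequence $(x_1,\ldots,x_l)$ is an $A$-weighted zero-sum sequence if $a_1x_1+\cdots+a_lx_l=0$ for some $a_i\in A$; subsequences are nonempty; $D_A(m)$ is the least $k$ such that every sequence of length $k$ in $\mathbb{Z}_m$ has an $A$-weighted zero-sum subsequence; an $A$-extremal sequence for the Davenport constant is a sequence of length $D_A(m)-1$ with no $A$-weighted zero-sum subsequence. If $A$ is a multiplicative group, sequences $(x_1,\ldots,x_k)$, $(y_1,\ldots,y_k)$ are equivalent with respect to $A$ if there are $a_i\in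 A$, a unit $c$ and a permutation $\sigma$ with $y_{\sigma(i)}=c\,a_ix_i$ for all $i$. For odd $m=\prod p_i^{r_i}$ and $a\in U(m)$, $\left(\frac{a}{m}\right)=\prod_i\left(\frac{a\bmod p_i}{p_i}\right)^{r_i}$, $\left(\frac{a}{p}\right)$ is the Legendre symbol of $a\bmod p$, and $L(m;p')=\{a\in U(m): \left(\frac{a}{m}\right)=\left(\frac{a}{p'}\right)\}$. -}

module Defs where

open import Data.Nat as ℕ using (ℕ; zero; suc; _≤_)
open import Data.Nat.Divisibility using (_∣?_) renaming (_∣_ to _∣ℕ_)
open import Data.Nat.Coprimality using (Coprime)
open import Data.Integer as ℤ using (ℤ; +_; ∣_∣)
open import Data.Fin using (Fin; toℕ)
open import Data.Fin.Properties using (any?)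
open import Data.Fin.Permutation using (Permutation′; _⟨$⟩ʳ_)
open import Data.Bool using (Bool; true; false; if_then_else_)
open import Data.List using (List; []; _∷_; map)
open import Data.Product using (Σ; ∃; _×_)
open import Relation.Nullary using (¬_; Dec; does)
open import Relation.Binary.PropositionalEquality using (_≡_)

sumF : ∀ {l} → (Fin l → ℕ) → ℕ
sumF {zero}  f = 0
sumF {suc l} f = f Fin.zero ℕ.+ sumF (λ i → f (Fin.suc i))

infix 4 _≡_[mod_]
_≡_[mod_] : ℕ → ℕ → ℕ → Set
a ≡ b [mod m ] = m ∣ℕ ∣ (+ a) ℤ.- (+ b) ∣

Unit : (m : ℕ) → Fin m → Set
Unit m a = Coprime (toℕ a) m

QSq : (q : ℕ) → Fin q → Set
QSq q a = Σ (Fin q) λ x → Unit q x × (toℕ x ℕ.* toℕ x ≡ toℕ a [mod q ])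

QR? : (a p : ℕ) → Dec (Σ (Fin p) λ x → toℕ x ℕ.* toℕ x ≡ a [mod p ])
QR? a p = any? (λ x → p ∣? ∣ (+ (toℕ x ℕ.* toℕ x)) ℤ.- (+ a) ∣)

legendre : ℕ → ℕ → ℤ
legendre a p =
  if does (p ∣? a) then + 0
  else (if does (QR? a p) then + 1 else ℤ.-[1+ 0 ])

-- Jacobi symbol (a/m) for m = p₁ p₂ ⋯ pₖ given as its list of prime
-- factors with multiplicity:  (a/m) = ∏ (a/pᵢ)
jacobi : ℕ → List ℕ → ℤ
jacobi a []       = + 1
jacobi a (p ∷ ps) = legendre a p ℤ.* jacobi a ps

L : (p' q : ℕ) → Fin (p' ℕ.* q) → Set
L p' q a = Unit (p' ℕ.* q) a × (jacobi (toℕ a) (p' ∷ q ∷ []) ≡ legendre (toℕ a) p')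

wsum : ∀ {l m} → (Fin l → Bool) → (Fin l → Fin m) → (Fin l → Fin m) → ℕ
wsum s w x = sumF (λ i → if s i then toℕ (w i) ℕ.* toℕ (x i) else 0)

HasWZS : ∀ {l} (m : ℕ) (A : Fin m → Set) → (Fin l → Fin m) → Set
HasWZS {l} m A x =
  Σ (Fin l → Bool) λ s → (∃ λ i → s i ≡ true) ×
    Σ (Fin l → Fin m) λ w → (∀ i → s i ≡ true → A (w i)) × (m ∣ℕ wsum s w x)

DavProp : (m : ℕ) (A : Fin m → Set) → ℕ → Set
DavProp m A k = (x : Fin k → Fin m) → HasWZS m A x

IsDavenport : (m : ℕ) (A : Fin m → Set) → ℕ → Set
IsDavenport m A k = DavProp m A k × (∀ j → DavProp m A j → k ≤ j)

Extremal : ∀ {l} (m : ℕ) (A : Fin m → Set) → (Fin l → Fin m) → Set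
Extremal {l} m A x = (∃ λ k → IsDavenport m A k × suc l ≡ k) × ¬ HasWZS m A x

Equiv : ∀ {k} (m : ℕ) (A : Fin m → Set) → (Fin k → Fin m) → (Fin k → Fin m) → Set
Equiv {k} m A x y =
  Σ (Fin k → Fin m) λ a → (∀ i → A (a i)) ×
  Σ (Fin m) λ c → Unit m c ×
  Σ (Permutation′ k) λ σ →
    ∀ i → toℕ (y (σ ⟨$⟩ʳ i)) ≡ toℕ c ℕ.* toℕ (a i) ℕ.* toℕ (x i) [mod m ]

ImageMod : ∀ {l n} (d : ℕ) → (Fin l → Fin n) → (Fin l → Fin d) → Set
ImageMod d y z = ∀ i → toℕ (z i) ≡ toℕ (y i) [mod d ]

-- A weight a ∈ L(p'q; p') is exactly a unit modulo p' that is a nonzero square modulo q (the Jacobi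
-- symbol factors), and by the Chinese remainder theorem such weights can be prescribed independently
-- modulo p' and modulo q. So a subsequence has an L-weighted zero-sum iff it has a unit-weighted
-- zero-sum modulo p' and a square-weighted zero-sum modulo q. Modulo p' the former fails only when
-- exactly one selected term is a unit. Modulo q ≥ 7 every residue is a difference of two nonzero
-- squares, so a square-weighted zero-sum of two terms, one of them a unit, absorbs any third term.
-- Since D_L(n) = 4, lifting w to (q, p'w₁, p'w₂, p'w₃) shows D_{Q_q}(q) ≤ 3. If a term of the extremal
-- sequence is divisible by q, move it to the front: either the other two are divisible by p' (case
-- (ii)) or neither is divisible by q (case (i)). Otherwise the three terms have a square-weighted
-- zero-sum modulo q, so exactly one of them is a unit modulo p', which is case (ii) after moving it
-- to the front.

module Submission where

open import Defs
open import Data.Nat as ℕ using (ℕ; _*_; _≤_; _<_; NonZero; s≤s; z≤n)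
open import Data.Nat.Divisibility as ℕ∣ using (_∣_; _∣?_)
open import Data.Nat.Primality using (Prime; euclidsLemma; prime⇒irreducible; prime⇒nonZero; prime⇒nonTrivial)
open import Data.Nat.Coprimality as Coprimality using (Coprime; coprime-divisor; coprime-Bézout)
open import Data.Fin as Fin using (Fin; toℕ; zero; suc; fromℕ<)
open import Data.Product using (Σ; ∃; _×_; _,_; proj₁; proj₂)
open import Data.Sum using (_⊎_; inj₁; inj₂; [_,_]′)
open import Relation.Nullary using (¬_; Dec; does; yes; no; contradiction)
open import Relation.Binary.PropositionalEquality as ≡ using (_≡_; _≢_; _≗_; refl; cong; cong₂)

import Data.Integer.Properties as ℤP
open import Algebra.Properties.Semiring.Sum ℤP.+-*-semiring
  using (sum; sum-cong-≗; sum-replicate-zero; ∑-permute; ∑-distrib-+; *-distribˡ-sum)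
open import Data.Bool using (Bool; true; false; if_then_else_; not)
open import Data.Bool.Properties using (not-involutive)
open import Data.Fin.Permutation as Perm using (Permutation′; _⟨$⟩ʳ_; _⟨$⟩ˡ_)
open import Data.Fin.Properties using (toℕ-fromℕ<; suc-injective; any?)
open import Data.Integer as ℤ using (ℤ; +_; _+_; _-_; -_; 0ℤ; 1ℤ) renaming (_*_ to _·_)
open import Data.Integer.DivMod using (_%ℕ_; _/ℕ_; n%ℕd<d; a≡a%ℕn+[a/ℕn]*n)
open import Data.Integer.Divisibility.Signed as ℤ∣ using (divides) renaming (_∣_ to _∣ᶻ_)
open import Data.Integer.Tactic.RingSolver using (solve-∀)
open import Data.Nat.GCD using (module Bézout)
open import Data.Nat.LCM using (lcm; lcm-least; gcd*lcm)
import Data.Nat.Properties as ℕP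
open import Data.Vec.Functional using ([]; _∷_)
open import Function using (_∘_)
open import Level using (0ℓ)
open import Relation.Binary.Bundles using (Setoid)
import Relation.Nullary.Decidable as Dec

-- Congruences

infix 4 _≋_[mod_]
-- A record rather than a synonym for divisibility, so that i and j can be inferred from the type.
record _≋_[mod_] (i j : ℤ) (m : ℕ) : Set where
  constructor modular
  field divisibility : + m ∣ᶻ i - j

module _ {m : ℕ} where

  private
    modular′ : ∀ {i j k} → i ≡ j - k → + m ∣ᶻ i → j ≋ k [mod m ]
    modular′ eq d = modular (≡.subst (+ m ∣ᶻ_) eq d)

  ≋-reflexive : ∀ {i j} → i ≡ j → i ≋ j [mod m ]
  ≋-reflexive {i} refl = modular′ (≡.sym (ℤP.+-inverseʳ i)) (divides 0ℤ refl)

  ≋-refl : ∀ {i} → i ≋ i [mod m ]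
  ≋-refl = ≋-reflexive refl

  ≋-sym : ∀ {i j} → i ≋ j [mod m ] → j ≋ i [mod m ]
  ≋-sym {i} {j} (modular d) = modular′ (eq i j) (ℤ∣.∣m⇒∣-m d)
    where eq : ∀ i j → - (i - j) ≡ j - i
          eq = solve-∀

  ≋-trans : ∀ {i j k} → i ≋ j [mod m ] → j ≋ k [mod m ] → i ≋ k [mod m ]
  ≋-trans {i} {j} {k} (modular d) (modular e) = modular′ (eq i j k) (ℤ∣.∣m∣n⇒∣m+n d e)
    where eq : ∀ i j k → (i - j) + (j - k) ≡ i - k
          eq = solve-∀

  +-cong : ∀ {i j k l} → i ≋ j [mod m ] → k ≋ l [mod m ] → i + k ≋ j + l [mod m ]
  +-cong {i} {j} {k} {l} (modular d) (modular e) = modular′ (eq i j k l) (ℤ∣.∣m∣n⇒∣m+n d e)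
    where eq : ∀ i j k l → (i - j) + (k - l) ≡ i + k - (j + l)
          eq = solve-∀

  ·-cong : ∀ {i j k l} → i ≋ j [mod m ] → k ≋ l [mod m ] → i · k ≋ j · l [mod m ]
  ·-cong {i} {j} {k} {l} (modular d) (modular e) =
    modular′ (eq i j k l) (ℤ∣.∣m∣n⇒∣m+n (ℤ∣.∣m⇒∣m*n k d) (ℤ∣.∣n⇒∣m*n j e))
    where eq : ∀ i j k l → (i - j) · k + j · (k - l) ≡ i · k - j · l
          eq = solve-∀

  -‿cong : ∀ {i j} → i ≋ j [mod m ] → - i ≋ - j [mod m ]
  -‿cong {i} {j} (modular d) = modular′ (eq i j) (ℤ∣.∣m⇒∣-m d)
    where eq : ∀ i j → - (i - j) ≡ - i - - j
          eq = solve-∀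

  ∣⇒≋0 : ∀ {i} → + m ∣ᶻ i → i ≋ 0ℤ [mod m ]
  ∣⇒≋0 {i} = modular′ (≡.sym (ℤP.+-identityʳ i))

  ≋0⇒∣ : ∀ {i} → i ≋ 0ℤ [mod m ] → + m ∣ᶻ i
  ≋0⇒∣ {i} (modular d) = ≡.subst (+ m ∣ᶻ_) (ℤP.+-identityʳ i) d

  ≋0? : ∀ i → Dec (i ≋ 0ℤ [mod m ])
  ≋0? i = Dec.map′ ∣⇒≋0 ≋0⇒∣ (+ m ℤ∣.∣? i)

  ℕ∣⇒≋0 : ∀ {a} → m ∣ a → + a ≋ 0ℤ [mod m ]
  ℕ∣⇒≋0 d = ∣⇒≋0 (ℤ∣.∣ᵤ⇒∣ d)

  ≋0⇒ℕ∣ : ∀ {a} → + a ≋ 0ℤ [mod m ] → m ∣ a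
  ≋0⇒ℕ∣ h = ℤ∣.∣⇒∣ᵤ (≋0⇒∣ h)

  ≡-mod⇒≋ : ∀ {a b} → a ≡ b [mod m ] → + a ≋ + b [mod m ]
  ≡-mod⇒≋ d = modular (ℤ∣.∣ᵤ⇒∣ d)

  ≋⇒≡-mod : ∀ {a b} → + a ≋ + b [mod m ] → a ≡ b [mod m ]
  ≋⇒≡-mod (modular d) = ℤ∣.∣⇒∣ᵤ d

  ≋-≉0 : ∀ {i j} → i ≋ j [mod m ] → ¬ j ≋ 0ℤ [mod m ] → ¬ i ≋ 0ℤ [mod m ]
  ≋-≉0 i≋j j≉0 i≋0 = j≉0 (≋-trans (≋-sym i≋j) i≋0)

  -‿≉0 : ∀ {i} → ¬ i ≋ 0ℤ [mod m ] → ¬ - i ≋ 0ℤ [mod m ]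
  -‿≉0 i≉0 -i≋0 = i≉0 (≋-trans (≋-reflexive (≡.sym (ℤP.neg-involutive _))) (-‿cong -i≋0))

  small≉0 : ∀ {k} → 0 < k → k < m → ¬ + k ≋ 0ℤ [mod m ]
  small≉0 {ℕ.suc k} _ k<m k≋0 = ℕP.<⇒≱ k<m (ℕ∣.∣⇒≤ (≋0⇒ℕ∣ k≋0))

≋-setoid : ℕ → Setoid 0ℓ 0ℓ
≋-setoid m = record
  { Carrier = ℤ
  ; _≈_ = _≋_[mod m ]
  ; isEquivalence = record { refl = ≋-refl ; sym = ≋-sym ; trans = ≋-trans }
  }

module ≋-Reasoning (m : ℕ) where
  open import Relation.Binary.Reasoning.Setoid (≋-setoid m) public

≋-weaken : ∀ {d m i j} → d ∣ m → i ≋ j [mod m ] → i ≋ j [mod d ]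
≋-weaken d∣m (modular m∣) = modular (ℤ∣.∣-trans (ℤ∣.∣ᵤ⇒∣ d∣m) m∣)

residue : ∀ m .{{_ : NonZero m}} → ℤ → Fin m
residue m i = fromℕ< (n%ℕd<d i m)

residue-≋ : ∀ m .{{_ : NonZero m}} i → + toℕ (residue m i) ≋ i [mod m ]
residue-≋ m i = ≋-sym (modular (divides (i /ℕ m) eq))
  where
  open ≡.≡-Reasoning
  r = i %ℕ m
  cancel : ∀ r k → (r + k) - r ≡ k
  cancel = solve-∀
  eq : i - + toℕ (residue m i) ≡ i /ℕ m · + m
  eq = begin
    i - + toℕ (residue m i)     ≡⟨ cong (λ k → i - + k) (toℕ-fromℕ< (n%ℕd<d i m)) ⟩
    i - + r                     ≡⟨ cong (_- + r) (a≡a%ℕn+[a/ℕn]*n i m) ⟩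
    (+ r + i /ℕ m · + m) - + r  ≡⟨ cancel (+ r) _ ⟩
    i /ℕ m · + m                ∎

-- Primes

prime>1 : ∀ {p} → Prime p → 1 < p
prime>1 {p} p-prime = ℕ.nonTrivial⇒n>1 p {{prime⇒nonTrivial p-prime}}

Inverse : ℕ → ℤ → Set
Inverse r i = Σ ℤ λ h → h · i ≋ 1ℤ [mod r ]

module _ {r : ℕ} (r-prime : Prime r) where

  private instance
    r-nonZero : NonZero r
    r-nonZero = prime⇒nonZero r-prime

  ¬∣⇒coprime : ∀ {a} → ¬ r ∣ a → Coprime a r
  ¬∣⇒coprime r∤a (d∣a , d∣r) with prime⇒irreducible r-prime d∣r
  ... | inj₁ d≡1 = d≡1
  ... | inj₂ refl = contradiction d∣a r∤a

  coprime⇒¬∣ : ∀ {a} → Coprime a r → ¬ r ∣ a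
  coprime⇒¬∣ c r∣a = ℕ.nonTrivial⇒≢1 {{prime⇒nonTrivial r-prime}} (c (r∣a , ℕ∣.∣-refl))

  ≋0-·⁻ : ∀ {i j} → i · j ≋ 0ℤ [mod r ] → i ≋ 0ℤ [mod r ] ⊎ j ≋ 0ℤ [mod r ]
  ≋0-·⁻ {i} {j} ij≋0 with euclidsLemma ℤ.∣ i ∣ ℤ.∣ j ∣ r-prime
    (≡.subst (r ∣_) (ℤP.abs-* i j) (ℤ∣.∣⇒∣ᵤ (≋0⇒∣ ij≋0)))
  ... | inj₁ r∣i = inj₁ (∣⇒≋0 (ℤ∣.∣ᵤ⇒∣ r∣i))
  ... | inj₂ r∣j = inj₂ (∣⇒≋0 (ℤ∣.∣ᵤ⇒∣ r∣j))

  ·-≉0 : ∀ {i j} → ¬ i ≋ 0ℤ [mod r ] → ¬ j ≋ 0ℤ [mod r ] → ¬ i · j ≋ 0ℤ [mod r ]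
  ·-≉0 i≉0 j≉0 ij≋0 with ≋0-·⁻ ij≋0
  ... | inj₁ i≋0 = i≉0 i≋0
  ... | inj₂ j≋0 = j≉0 j≋0

  private
    bézout-inverse : ∀ {a} → Coprime a r → Inverse r (+ a)
    bézout-inverse {a} c with coprime-Bézout c
    ... | Bézout.+- x y eq = + x , modular (divides (+ y) (begin
      + x · + a - 1ℤ        ≡⟨ cong (_- 1ℤ) (ℤP.pos-* x a) ⟨
      + (x * a) - 1ℤ        ≡⟨ cong (λ k → + k - 1ℤ) eq ⟨
      + (1 ℕ.+ y * r) - 1ℤ  ≡⟨ cong (λ k → k - 1ℤ) (≡.trans (ℤP.pos-+ 1 _) (cong (λ k → 1ℤ + k) (ℤP.pos-* y r))) ⟩
      1ℤ + + y · + r - 1ℤ   ≡⟨ cancel (+ y · + r) ⟩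
      + y · + r             ∎))
      where
      open ≡.≡-Reasoning
      cancel : ∀ k → 1ℤ + k - 1ℤ ≡ k
      cancel = solve-∀
    ... | Bézout.-+ x y eq = - + x , modular (divides (- + y) (begin
      - + x · + a - 1ℤ    ≡⟨ cong (_- 1ℤ) (ℤP.neg-distribˡ-* (+ x) (+ a)) ⟨
      - (+ x · + a) - 1ℤ  ≡⟨ cong (λ k → - k - 1ℤ) (ℤP.pos-* x a) ⟨
      - + (x * a) - 1ℤ    ≡⟨ shuffle (+ (x * a)) ⟩
      - (1ℤ + + (x * a))  ≡⟨ cong -_ (ℤP.pos-+ 1 (x * a)) ⟨
      - + (1 ℕ.+ x * a)   ≡⟨ cong (λ k → - + k) eq ⟩
      - + (y * r)         ≡⟨ cong -_ (ℤP.pos-* y r) ⟩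
      - (+ y · + r)       ≡⟨ ℤP.neg-distribˡ-* (+ y) (+ r) ⟩
      - + y · + r         ∎))
      where
      open ≡.≡-Reasoning
      shuffle : ∀ k → - k - 1ℤ ≡ - (1ℤ + k)
      shuffle = solve-∀

  inverse : ∀ {i} → ¬ i ≋ 0ℤ [mod r ] → Inverse r i
  inverse {i} i≉0 = transport (bézout-inverse (¬∣⇒coprime (≋-≉0 (residue-≋ r i) i≉0 ∘ ℕ∣⇒≋0)))
    where
    transport : Inverse r (+ toℕ (residue r i)) → Inverse r i
    transport (h , ha≋1) = h , ≋-trans (·-cong (≋-refl {i = h}) (≋-sym (residue-≋ r i))) ha≋1

coprime-* : ∀ {a m n} → Coprime a m → Coprime a n → Coprime a (m * n)
coprime-* a⊥m a⊥n (d∣a , d∣mn) =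
  a⊥n (d∣a , coprime-divisor (λ (e∣d , e∣m) → a⊥m (ℕ∣.∣-trans e∣d d∣a , e∣m)) d∣mn)

coprime-*∣ : ∀ {m n k} → Coprime m n → m ∣ k → n ∣ k → m * n ∣ k
coprime-*∣ {m} {n} m⊥n m∣k n∣k = ≡.subst (_∣ _) lcm≡mn (lcm-least m∣k n∣k)
  where
  lcm≡mn : lcm m n ≡ m * n
  lcm≡mn = ≡.trans (≡.sym (ℕP.*-identityˡ _))
    (≡.trans (cong (_* lcm m n) (≡.sym (Coprimality.coprime⇒gcd≡1 m⊥n))) (gcd*lcm m n))

primes-coprime : ∀ {p q} → Prime p → Prime q → p ≢ q → Coprime p q
primes-coprime p-prime q-prime p≢q = ¬∣⇒coprime q-prime λ q∣p →
  [ (λ q≡1 → ℕ.nonTrivial⇒≢1 {{prime⇒nonTrivial q-prime}} q≡1) , (λ q≡p → p≢q (≡.sym q≡p)) ]′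
    (prime⇒irreducible p-prime q∣p)

≋-combine : ∀ {m n i j} → Coprime m n → i ≋ j [mod m ] → i ≋ j [mod n ] → i ≋ j [mod m * n ]
≋-combine m⊥n (modular m∣) (modular n∣) =
  modular (ℤ∣.∣ᵤ⇒∣ (coprime-*∣ m⊥n (ℤ∣.∣⇒∣ᵤ m∣) (ℤ∣.∣⇒∣ᵤ n∣)))

-- Selected sums

selectedSum : ∀ {l} → (Fin l → Bool) → (Fin l → ℤ) → (Fin l → ℤ) → ℤ
selectedSum s α X = sum (λ i → if s i then α i · X i else 0ℤ)

sum-cong-≋ : ∀ {l m} {f g : Fin l → ℤ} → (∀ i → f i ≋ g i [mod m ]) → sum f ≋ sum g [mod m ]
sum-cong-≋ {ℕ.zero}  f≋g = ≋-refl
sum-cong-≋ {ℕ.suc l} f≋g = +-cong (f≋g zero) (sum-cong-≋ (f≋g ∘ suc))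

selectedSum-cong : ∀ {l} {m} (s : Fin l → Bool) {α α′ X X′ : Fin l → ℤ} →
  (∀ i → α i ≋ α′ i [mod m ]) → (∀ i → X i ≋ X′ i [mod m ]) →
  selectedSum s α X ≋ selectedSum s α′ X′ [mod m ]
selectedSum-cong {m = m} s {α} {α′} {X} {X′} α≋α′ X≋X′ = sum-cong-≋ term-cong
  where
  term-cong : ∀ i → (if s i then α i · X i else 0ℤ) ≋ (if s i then α′ i · X′ i else 0ℤ) [mod m ]
  term-cong i with s i
  ... | true  = ·-cong (α≋α′ i) (X≋X′ i)
  ... | false = ≋-refl

selectedSum-≗ : ∀ {l} {s s′ : Fin l → Bool} {α α′ X X′ : Fin l → ℤ} → s ≗ s′ → α ≗ α′ → X ≗ X′ →
  selectedSum s α X ≡ selectedSum s′ α′ X′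
selectedSum-≗ {s = s} {s′} {α} {α′} {X} {X′} s≗s′ α≗α′ X≗X′ = sum-cong-≗ term
  where
  term : ∀ i → (if s i then α i · X i else 0ℤ) ≡ (if s′ i then α′ i · X′ i else 0ℤ)
  term i rewrite s≗s′ i | α≗α′ i | X≗X′ i = refl

selectedSum-≋0 : ∀ {l m} (s : Fin l → Bool) (α : Fin l → ℤ) {X : Fin l → ℤ} →
  (∀ i → s i ≡ true → X i ≋ 0ℤ [mod m ]) → selectedSum s α X ≋ 0ℤ [mod m ]
selectedSum-≋0 {l} {m} s α {X} selected≋0 =
  ≋-trans (sum-cong-≋ term≋0) (≋-reflexive (sum-replicate-zero l))
  where
  term≋0 : ∀ i → (if s i then α i · X i else 0ℤ) ≋ 0ℤ [mod m ]
  term≋0 i with s i in sᵢ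
  ... | true  = ≋-trans (·-cong (≋-refl {i = α i}) (selected≋0 i sᵢ)) (≋-reflexive (ℤP.*-zeroʳ (α i)))
  ... | false = ≋-refl

selectedSum-scale : ∀ {l} (s : Fin l → Bool) (α X : Fin l → ℤ) c →
  selectedSum s α (λ i → c · X i) ≡ c · selectedSum s α X
selectedSum-scale s α X c =
  ≡.trans (sum-cong-≗ term) (≡.sym (*-distribˡ-sum c (λ i → if s i then α i · X i else 0ℤ)))
  where
  term : ∀ i → (if s i then α i · (c · X i) else 0ℤ) ≡ c · (if s i then α i · X i else 0ℤ)
  term i with s i
  ... | true  = swap (α i) c (X i)
    where swap : ∀ a c x → a · (c · x) ≡ c · (a · x)
          swap = solve-∀
  ... | false = ≡.sym (ℤP.*-zeroʳ c)

selectedSum-on-selection : ∀ {l} (s : Fin l → Bool) {α α′ : Fin l → ℤ} (X : Fin l → ℤ) →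
  (∀ i → s i ≡ true → α i ≡ α′ i) → selectedSum s α X ≡ selectedSum s α′ X
selectedSum-on-selection s {α} {α′} X α≡α′ = sum-cong-≗ term
  where
  term : ∀ i → (if s i then α i · X i else 0ℤ) ≡ (if s i then α′ i · X i else 0ℤ)
  term i with s i in sᵢ
  ... | true  = cong (_· X i) (α≡α′ i sᵢ)
  ... | false = refl

selectedSum-permute : ∀ {l} (π : Permutation′ l) (s : Fin l → Bool) (α X : Fin l → ℤ) →
  selectedSum s α X ≡ selectedSum (s ∘ (π ⟨$⟩ʳ_)) (α ∘ (π ⟨$⟩ʳ_)) (X ∘ (π ⟨$⟩ʳ_))
selectedSum-permute π s α X = ∑-permute _ π

selectedSum-split : ∀ {l} (s : Fin l → Bool) (α X : Fin l → ℤ) →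
  selectedSum (λ _ → true) α X ≡ selectedSum s α X + selectedSum (not ∘ s) α X
selectedSum-split s α X = ≡.trans (sum-cong-≗ split)
  (∑-distrib-+ (λ i → if s i then α i · X i else 0ℤ) (λ i → if not (s i) then α i · X i else 0ℤ))
  where
  split : ∀ i → α i · X i ≡ (if s i then α i · X i else 0ℤ) + (if not (s i) then α i · X i else 0ℤ)
  split i with s i
  ... | true  = ≡.sym (ℤP.+-identityʳ _)
  ... | false = ≡.sym (ℤP.+-identityˡ _)

selectedSum-none : ∀ {l} (s : Fin l → Bool) (α X : Fin l → ℤ) → (∀ i → s i ≡ false) →
  selectedSum s α X ≡ 0ℤ
selectedSum-none {ℕ.zero}  s α X none = refl
selectedSum-none {ℕ.suc l} s α X none rewrite none zero =
  ≡.trans (ℤP.+-identityˡ _) (selectedSum-none (s ∘ suc) (α ∘ suc) (X ∘ suc) (none ∘ suc))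

selectedSum-single : ∀ {l} (s : Fin l → Bool) (α X : Fin l → ℤ) {i} →
  s i ≡ true → (∀ j → s j ≡ true → j ≡ i) → selectedSum s α X ≡ α i · X i
selectedSum-single s α X {zero} sᵢ only rewrite sᵢ =
  ≡.trans (cong (λ k → α zero · X zero + k) (selectedSum-none (s ∘ suc) (α ∘ suc) (X ∘ suc) none))
          (ℤP.+-identityʳ _)
  where
  none : ∀ j → s (suc j) ≡ false
  none j with s (suc j) in sⱼ
  ... | true  = contradiction (only (suc j) sⱼ) λ ()
  ... | false = refl
selectedSum-single s α X {suc i} sᵢ only with s zero in s₀
... | true  = contradiction (only zero s₀) λ ()
... | false = ≡.trans (ℤP.+-identityˡ _)
  (selectedSum-single (s ∘ suc) (α ∘ suc) (X ∘ suc) sᵢ λ j sⱼ → suc-injective (only (suc j) sⱼ))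

wsum≡selectedSum : ∀ {l m} (s : Fin l → Bool) (w x : Fin l → Fin m) →
  + wsum s w x ≡ selectedSum s (λ i → + toℕ (w i)) (λ i → + toℕ (x i))
wsum≡selectedSum {ℕ.zero}  s w x = refl
wsum≡selectedSum {ℕ.suc l} s w x = ≡.trans (ℤP.pos-+ (if s zero then toℕ (w zero) * toℕ (x zero) else 0) _)
  (cong₂ _+_ (head-term (s zero)) (wsum≡selectedSum (s ∘ suc) (w ∘ suc) (x ∘ suc)))
  where
  head-term : ∀ b → + (if b then toℕ (w zero) * toℕ (x zero) else 0)
                  ≡ (if b then + toℕ (w zero) · + toℕ (x zero) else 0ℤ)
  head-term true  = ℤP.pos-* (toℕ (w zero)) (toℕ (x zero))
  head-term false = refl

-- Zero-sum subsequences

DavProp-suc : ∀ {m A k} → DavProp m A k → DavProp m A (ℕ.suc k)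
DavProp-suc {m} {A} dav x with dav (x ∘ suc)
... | s , (i , sᵢ) , w , w∈A , m∣Σ = false ∷ s , (suc i , sᵢ) , x zero ∷ w , weights∈A , m∣Σ
  where
  weights∈A : ∀ i → (false ∷ s) i ≡ true → A ((x zero ∷ w) i)
  weights∈A zero    ()
  weights∈A (suc i) = w∈A i

DavProp-mono : ∀ {m A j k} → j ℕ.≤′ k → DavProp m A j → DavProp m A k
DavProp-mono               ℕ.≤′-refl        dav = dav
DavProp-mono {m} {A} {j} (ℕ.≤′-step j≤′k) dav = DavProp-suc {m} {A} (DavProp-mono {m} {A} {j} j≤′k dav)

free⇒extremal : ∀ {l m A} {x : Fin l → Fin m} → DavProp m A (ℕ.suc l) → ¬ HasWZS m A x → Extremal m A x
free⇒extremal {l} {m} {A} {x} dav x-free = (ℕ.suc l , (dav , least) , refl) , x-free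
  where
  least : ∀ j → DavProp m A j → ℕ.suc l ≤ j
  least j dav-j with ℕ.suc l ℕ.≤? j
  ... | yes l<j = l<j
  ... | no  l≮j = contradiction (DavProp-mono {m} {A} (ℕP.≤⇒≤′ (ℕP.≤-pred (ℕP.≰⇒> l≮j))) dav-j x) x-free

HasWZS-permute : ∀ {l m A} {x : Fin l → Fin m} (π : Permutation′ l) →
  HasWZS m A (x ∘ (π ⟨$⟩ʳ_)) → HasWZS m A x
HasWZS-permute {x = x} π (s , (i , sᵢ) , w , w∈A , m∣Σ) =
  s ∘ (π ⟨$⟩ˡ_) , (π ⟨$⟩ʳ i , ≡.trans (cong s (Perm.inverseˡ π)) sᵢ) ,
  w ∘ (π ⟨$⟩ˡ_) , (λ j → w∈A (π ⟨$⟩ˡ j)) , ≡.subst (_ ∣_) (ℤP.+-injective sums≡) m∣Σ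
  where
  open ≡.≡-Reasoning
  X = λ i → + toℕ (x i)
  W = λ i → + toℕ (w i)
  sums≡ : + wsum s w (x ∘ (π ⟨$⟩ʳ_)) ≡ + wsum (s ∘ (π ⟨$⟩ˡ_)) (w ∘ (π ⟨$⟩ˡ_)) x
  sums≡ = begin
    + wsum s w (x ∘ (π ⟨$⟩ʳ_))
      ≡⟨ wsum≡selectedSum s w (x ∘ (π ⟨$⟩ʳ_)) ⟩
    selectedSum s W (X ∘ (π ⟨$⟩ʳ_))
      ≡⟨ selectedSum-permute (Perm.flip π) s W (X ∘ (π ⟨$⟩ʳ_)) ⟩
    selectedSum (s ∘ (π ⟨$⟩ˡ_)) (W ∘ (π ⟨$⟩ˡ_)) (X ∘ (π ⟨$⟩ʳ_) ∘ (π ⟨$⟩ˡ_))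
      ≡⟨ selectedSum-≗ {s = s ∘ (π ⟨$⟩ˡ_)} {α = W ∘ (π ⟨$⟩ˡ_)} {X = X ∘ (π ⟨$⟩ʳ_) ∘ (π ⟨$⟩ˡ_)}
           (λ _ → refl) (λ _ → refl) (λ _ → cong X (Perm.inverseʳ π)) ⟩
    selectedSum (s ∘ (π ⟨$⟩ˡ_)) (W ∘ (π ⟨$⟩ˡ_)) X
      ≡⟨ wsum≡selectedSum (s ∘ (π ⟨$⟩ˡ_)) (w ∘ (π ⟨$⟩ˡ_)) x ⟨
    + wsum (s ∘ (π ⟨$⟩ˡ_)) (w ∘ (π ⟨$⟩ˡ_)) x ∎

Equiv-permute : ∀ {l m A} (one : Fin m) → A one → Unit m one → + toℕ one ≋ 1ℤ [mod m ] →
  (x : Fin l → Fin m) (π : Permutation′ l) → Equiv m A x (x ∘ (π ⟨$⟩ʳ_))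
Equiv-permute {m = m} one one∈A one-unit one≋1 x π =
  (λ _ → one) , (λ _ → one∈A) , one , one-unit , Perm.flip π , scaled
  where
  scaled : ∀ i → toℕ (x (π ⟨$⟩ʳ (π ⟨$⟩ˡ i))) ≡ toℕ one * toℕ one * toℕ (x i) [mod m ]
  scaled i rewrite Perm.inverseʳ π {i} = ≋⇒≡-mod (begin
    + toℕ (x i)                          ≡⟨ ℤP.*-identityˡ _ ⟨
    1ℤ · 1ℤ · + toℕ (x i)                ≈⟨ ·-cong (·-cong one≋1 one≋1) ≋-refl ⟨
    + toℕ one · + toℕ one · + toℕ (x i)  ≡⟨ cong (_· + toℕ (x i)) (ℤP.pos-* (toℕ one) (toℕ one)) ⟨
    + (toℕ one * toℕ one) · + toℕ (x i)  ≡⟨ ℤP.pos-* (toℕ one * toℕ one) (toℕ (x i)) ⟨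
    + (toℕ one * toℕ one * toℕ (x i))    ∎)
    where open ≋-Reasoning m

-- Local zero-sums

-- Unlike in HasWZS, the weights at unselected positions must lie in W as well.
record WeightedZeroSum {l} (d : ℕ) (W : ℤ → Set) (s : Fin l → Bool) (X : Fin l → ℤ) : Set where
  constructor weighted
  field
    weights : Fin l → ℤ
    weights∈W : ∀ i → W (weights i)
    sum≋0 : selectedSum s weights X ≋ 0ℤ [mod d ]

module _ {l d : ℕ} {W : ℤ → Set} where

  weightedZeroSum-divisible : ∀ {s : Fin l → Bool} {X} → W 1ℤ →
    (∀ i → s i ≡ true → X i ≋ 0ℤ [mod d ]) → WeightedZeroSum d W s X
  weightedZeroSum-divisible {s} W1 selected≋0 =
    weighted (λ _ → 1ℤ) (λ _ → W1) (selectedSum-≋0 s (λ _ → 1ℤ) selected≋0)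

  weightedZeroSum-complete : ∀ {s : Fin l → Bool} {X} → WeightedZeroSum d W s X →
    (∀ i → s i ≡ false → X i ≋ 0ℤ [mod d ]) → WeightedZeroSum d W (λ _ → true) X
  weightedZeroSum-complete {s} {X} (weighted α α∈W Σ≋0) unselected≋0 = weighted α α∈W (begin
    selectedSum (λ _ → true) α X                   ≡⟨ selectedSum-split s α X ⟩
    selectedSum s α X + selectedSum (not ∘ s) α X  ≈⟨ +-cong Σ≋0 (selectedSum-≋0 (not ∘ s) α unselected≋0′) ⟩
    0ℤ + 0ℤ                                        ≡⟨⟩
    0ℤ                                             ∎)
    where
    open ≋-Reasoning d
    unselected≋0′ : ∀ i → not (s i) ≡ true → X i ≋ 0ℤ [mod d ]
    unselected≋0′ i ¬sᵢ = unselected≋0 i (≡.trans (≡.sym (not-involutive (s i))) (cong not ¬sᵢ))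

  weightedZeroSum-≗ : ∀ {s s′ : Fin l → Bool} {X} → s ≗ s′ →
    WeightedZeroSum d W s X → WeightedZeroSum d W s′ X
  weightedZeroSum-≗ {s} {s′} {X} s≗s′ (weighted α α∈W Σ≋0) = weighted α α∈W
    (≋-trans (≋-reflexive (selectedSum-≗ {s = s′} {s} {α} {α} {X} {X} (≡.sym ∘ s≗s′) (λ _ → refl) (λ _ → refl))) Σ≋0)

weightedZeroSum-prepend : ∀ {l d W} {s : Fin l → Bool} {X : Fin (ℕ.suc l) → ℤ} → W 1ℤ →
  WeightedZeroSum d W s (X ∘ suc) → WeightedZeroSum d W (false ∷ s) X
weightedZeroSum-prepend W1 (weighted α α∈W Σ≋0) =
  weighted (1ℤ ∷ α) (λ { zero → W1 ; (suc i) → α∈W i }) (≋-trans (≋-reflexive (ℤP.+-identityˡ _)) Σ≋0)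

weightedZeroSum-single : ∀ {l d W} {s : Fin l → Bool} {X i} → Prime d →
  (∀ {a} → W a → ¬ a ≋ 0ℤ [mod d ]) → s i ≡ true → (∀ j → s j ≡ true → j ≡ i) →
  WeightedZeroSum d W s X → X i ≋ 0ℤ [mod d ]
weightedZeroSum-single {s = s} {X} {i} d-prime W⇒≉0 sᵢ only (weighted α α∈W Σ≋0) =
  [ (λ αᵢ≋0 → contradiction αᵢ≋0 (W⇒≉0 (α∈W i))) , (λ Xᵢ≋0 → Xᵢ≋0) ]′
    (≋0-·⁻ d-prime (≋-trans (≋-reflexive (≡.sym (selectedSum-single s α X sᵢ only))) Σ≋0))

-- Squares modulo q

QuadraticResidue : ℕ → ℕ → Set
QuadraticResidue a p = Σ (Fin p) λ x → toℕ x * toℕ x ≡ a [mod p ]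

NonzeroSquare : ℕ → ℤ → Set
NonzeroSquare q i = Σ ℤ λ t → ¬ t ≋ 0ℤ [mod q ] × t · t ≋ i [mod q ]

nonzeroSquare-≋ : ∀ {q i j} → i ≋ j [mod q ] → NonzeroSquare q i → NonzeroSquare q j
nonzeroSquare-≋ i≋j (t , t≉0 , t²≋i) = t , t≉0 , ≋-trans t²≋i i≋j

nonzeroSquare-1 : ∀ {q} → 1 < q → NonzeroSquare q 1ℤ
nonzeroSquare-1 1<q = 1ℤ , small≉0 (s≤s z≤n) 1<q , ≋-refl

module _ {q : ℕ} (q-prime : Prime q) where

  private instance
    q-nonZero : NonZero q
    q-nonZero = prime⇒nonZero q-prime

  nonzeroSquare-≉0 : ∀ {i} → NonzeroSquare q i → ¬ i ≋ 0ℤ [mod q ]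
  nonzeroSquare-≉0 (t , t≉0 , t²≋i) = ≋-≉0 (≋-sym t²≋i) (·-≉0 q-prime t≉0 t≉0)

  nonzeroSquare-· : ∀ {c X} → NonzeroSquare q c → ¬ X ≋ 0ℤ [mod q ] → NonzeroSquare q (c · (X · X))
  nonzeroSquare-· {c} {X} (t , t≉0 , t²≋c) X≉0 = t · X , ·-≉0 q-prime t≉0 X≉0 , (begin
    t · X · (t · X)  ≡⟨ rearrange t X ⟩
    t · t · (X · X)  ≈⟨ ·-cong t²≋c ≋-refl ⟩
    c · (X · X)      ∎)
    where
    open ≋-Reasoning q
    rearrange : ∀ t X → t · X · (t · X) ≡ t · t · (X · X)
    rearrange = solve-∀

  nonzeroSquare⇒root : ∀ {a} → NonzeroSquare q (+ a) →
    Σ (Fin q) λ x → Unit q x × toℕ x * toℕ x ≡ a [mod q ]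
  nonzeroSquare⇒root {a} (t , t≉0 , t²≋a) = x , ¬∣⇒coprime q-prime (x≉0 ∘ ℕ∣⇒≋0) , ≋⇒≡-mod (begin
    + (toℕ x * toℕ x)  ≡⟨ ℤP.pos-* (toℕ x) (toℕ x) ⟩
    + toℕ x · + toℕ x  ≈⟨ ·-cong (residue-≋ q t) (residue-≋ q t) ⟩
    t · t              ≈⟨ t²≋a ⟩
    + a                ∎)
    where
    open ≋-Reasoning q
    x = residue q t
    x≉0 = ≋-≉0 (residue-≋ q t) t≉0

  quadraticResidue⇒nonzeroSquare : ∀ {a} → ¬ q ∣ a → QuadraticResidue a q → NonzeroSquare q (+ a)
  quadraticResidue⇒nonzeroSquare {a} q∤a (x , x²≡a) =
    + toℕ x , x≉0 , ≋-trans (≋-reflexive (≡.sym (ℤP.pos-* (toℕ x) (toℕ x)))) (≡-mod⇒≋ x²≡a)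
    where
    x≉0 : ¬ + toℕ x ≋ 0ℤ [mod q ]
    x≉0 x≋0 = q∤a (≋0⇒ℕ∣ (≋-trans (≋-sym (≡-mod⇒≋ x²≡a))
      (≋-trans (≋-reflexive (ℤP.pos-* (toℕ x) (toℕ x))) (·-cong x≋0 (≋-refl {i = + toℕ x})))))

  QSq⇒nonzeroSquare : ∀ {b} → QSq q b → NonzeroSquare q (+ toℕ b)
  QSq⇒nonzeroSquare (x , x-unit , x²≡b) =
    + toℕ x , coprime⇒¬∣ q-prime x-unit ∘ ≋0⇒ℕ∣ ,
    ≋-trans (≋-reflexive (≡.sym (ℤP.pos-* (toℕ x) (toℕ x)))) (≡-mod⇒≋ x²≡b)

  nonzeroSquare⇒QSq : ∀ {i} → NonzeroSquare q i → QSq q (residue q i)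
  nonzeroSquare⇒QSq {i} i-square = nonzeroSquare⇒root (nonzeroSquare-≋ (≋-sym (residue-≋ q i)) i-square)

DifferenceOfSquares : ℕ → ℤ → Set
DifferenceOfSquares q f =
  Σ ℤ λ X → Σ ℤ λ Y → ¬ X ≋ 0ℤ [mod q ] × ¬ Y ≋ 0ℤ [mod q ] × X · X - Y · Y ≋ f [mod q ]

SquareCombination : ℕ → ℤ → ℤ → ℤ → Set
SquareCombination q A B C =
  Σ ℤ λ β₀ → Σ ℤ λ β₁ → NonzeroSquare q β₀ × NonzeroSquare q β₁ × β₀ · A + β₁ · B + C ≋ 0ℤ [mod q ]

≉0-shift : ∀ {m i j c} → i ≋ 0ℤ [mod m ] → j ≡ i + c → ¬ c ≋ 0ℤ [mod m ] → ¬ j ≋ 0ℤ [mod m ]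
≉0-shift {c = c} i≋0 refl = ≋-≉0 (≋-trans (+-cong i≋0 (≋-refl {i = c})) (≋-reflexive (ℤP.+-identityˡ c)))

module _ {q : ℕ} (q-prime : Prime q) (7≤q : 7 ≤ q) where

  private
    small≉0′ : ∀ k → 0 < k → k < 7 → ¬ + k ≋ 0ℤ [mod q ]
    small≉0′ k 0<k k<7 = small≉0 0<k (ℕP.<-≤-trans k<7 7≤q)

    -small≉0 : ∀ k → 0 < k → k < 7 → ¬ - + k ≋ 0ℤ [mod q ]
    -small≉0 k 0<k k<7 = -‿≉0 (small≉0′ k 0<k k<7)

    shift : ∀ f a b → f + a ≡ (f + b) + (a - b)
    shift = solve-∀

  -- With h = (2d)⁻¹, X = (f + d²) h and Y = (f − d²) h satisfy X² − Y² = f (2dh)².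
  differenceOfSquares-via : ∀ {f} d → ¬ + 2 · d ≋ 0ℤ [mod q ] →
    ¬ f + d · d ≋ 0ℤ [mod q ] → ¬ f - d · d ≋ 0ℤ [mod q ] → DifferenceOfSquares q f
  differenceOfSquares-via {f} d 2d≉0 f+d²≉0 f-d²≉0 = squares (inverse q-prime 2d≉0)
    where
    open ≋-Reasoning q
    expand : ∀ f d h → (f + d · d) · h · ((f + d · d) · h) - (f - d · d) · h · ((f - d · d) · h)
                     ≡ f · (h · (+ 2 · d) · (h · (+ 2 · d)))
    expand = solve-∀
    squares : Inverse q (+ 2 · d) → DifferenceOfSquares q f
    squares (h , h2d≋1) = (f + d · d) · h , (f - d · d) · h , ·-≉0 q-prime f+d²≉0 h≉0 , ·-≉0 q-prime f-d²≉0 h≉0 , (begin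
      (f + d · d) · h · ((f + d · d) · h) - (f - d · d) · h · ((f - d · d) · h)
        ≡⟨ expand f d h ⟩
      f · (h · (+ 2 · d) · (h · (+ 2 · d)))  ≈⟨ ·-cong (≋-refl {i = f}) (·-cong h2d≋1 h2d≋1) ⟩
      f · (1ℤ · 1ℤ)                          ≡⟨ ℤP.*-identityʳ f ⟩
      f                                      ∎)
      where
      h≉0 : ¬ h ≋ 0ℤ [mod q ]
      h≉0 h≋0 = small≉0′ 1 (s≤s z≤n) (s≤s (s≤s z≤n))
        (≋-trans (≋-sym h2d≋1) (·-cong h≋0 (≋-refl {i = + 2 · d})))

  differenceOfSquares : ∀ f → DifferenceOfSquares q f
  differenceOfSquares f = choose (≋0? (f + 1ℤ)) (≋0? (f - 1ℤ))
    where
    -- d = 2 works when f ≡ ±1, as q divides none of 3, 4, 5; otherwise d = 1 works.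
    choose : Dec (f + 1ℤ ≋ 0ℤ [mod q ]) → Dec (f - 1ℤ ≋ 0ℤ [mod q ]) → DifferenceOfSquares q f
    choose (yes f+1≋0) _ = differenceOfSquares-via (+ 2) (small≉0′ 4 (s≤s z≤n) (ℕP.m≤n+m 5 2))
      (≉0-shift f+1≋0 (shift f (+ 4) 1ℤ) (small≉0′ 3 (s≤s z≤n) (ℕP.m≤n+m 4 3)))
      (≉0-shift f+1≋0 (shift f (- + 4) 1ℤ) (-small≉0 5 (s≤s z≤n) (ℕP.m≤n+m 6 1)))
    choose (no _) (yes f-1≋0) = differenceOfSquares-via (+ 2) (small≉0′ 4 (s≤s z≤n) (ℕP.m≤n+m 5 2))
      (≉0-shift f-1≋0 (shift f (+ 4) (- 1ℤ)) (small≉0′ 5 (s≤s z≤n) (ℕP.m≤n+m 6 1)))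
      (≉0-shift f-1≋0 (shift f (- + 4) (- 1ℤ)) (-small≉0 3 (s≤s z≤n) (ℕP.m≤n+m 4 3)))
    choose (no f+1≉0) (no f-1≉0) = differenceOfSquares-via 1ℤ (small≉0′ 2 (s≤s z≤n) (ℕP.m≤n+m 3 4)) f+1≉0 f-1≉0

  -- Choose X² − Y² ≡ −C / (c₀ A); then the weights c₀ X², c₁ Y² absorb C.
  squareWeights-absorb : ∀ {c₀ c₁ A B} → NonzeroSquare q c₀ → NonzeroSquare q c₁ → ¬ A ≋ 0ℤ [mod q ] →
    c₀ · A + c₁ · B ≋ 0ℤ [mod q ] → ∀ C → SquareCombination q A B C
  squareWeights-absorb {c₀} {c₁} {A} {B} c₀-square c₁-square A≉0 Σ≋0 C =
    absorb (inverse q-prime (·-≉0 q-prime (nonzeroSquare-≉0 q-prime c₀-square) A≉0))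
    where
    open ≋-Reasoning q
    regroup : ∀ c₀ c₁ A B C X Y → c₀ · (X · X) · A + c₁ · (Y · Y) · B + C
                                ≡ c₀ · A · (X · X - Y · Y) + Y · Y · (c₀ · A + c₁ · B) + C
    regroup = solve-∀
    regroup′ : ∀ c₀ A C g Y → c₀ · A · - (C · g) + Y · Y · 0ℤ + C ≡ - (C · (g · (c₀ · A))) + C
    regroup′ = solve-∀
    cancel : ∀ C → - (C · 1ℤ) + C ≡ 0ℤ
    cancel = solve-∀
    absorb : Inverse q (c₀ · A) → SquareCombination q A B C
    absorb (g , gc₀A≋1) = weights (differenceOfSquares (- (C · g)))
      where
      weights : DifferenceOfSquares q (- (C · g)) → SquareCombination q A B C
      weights (X , Y , X≉0 , Y≉0 , X²-Y²≋f) =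
        c₀ · (X · X) , c₁ · (Y · Y) , nonzeroSquare-· q-prime c₀-square X≉0 , nonzeroSquare-· q-prime c₁-square Y≉0 , (begin
        c₀ · (X · X) · A + c₁ · (Y · Y) · B + C
          ≡⟨ regroup c₀ c₁ A B C X Y ⟩
        c₀ · A · (X · X - Y · Y) + Y · Y · (c₀ · A + c₁ · B) + C
          ≈⟨ +-cong (+-cong (·-cong (≋-refl {i = c₀ · A}) X²-Y²≋f) (·-cong (≋-refl {i = Y · Y}) Σ≋0)) ≋-refl ⟩
        c₀ · A · - (C · g) + Y · Y · 0ℤ + C
          ≡⟨ regroup′ c₀ A C g Y ⟩
        - (C · (g · (c₀ · A))) + C
          ≈⟨ +-cong (-‿cong (·-cong (≋-refl {i = C}) gc₀A≋1)) ≋-refl ⟩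
        - (C · 1ℤ) + C
          ≡⟨ cancel C ⟩
        0ℤ ∎)

UnitZeroSum : ∀ {l} → ℕ → (Fin l → Bool) → (Fin l → ℤ) → Set
UnitZeroSum p = WeightedZeroSum p (λ a → ¬ a ≋ 0ℤ [mod p ])

SquareZeroSum : ∀ {l} → ℕ → (Fin l → Bool) → (Fin l → ℤ) → Set
SquareZeroSum q = WeightedZeroSum q (NonzeroSquare q)

η₃ : ∀ {A : Set} (s : Fin 3 → A) → s ≗ (s zero ∷ s (suc zero) ∷ s (suc (suc zero)) ∷ [])
η₃ s zero = refl
η₃ s (suc zero) = refl
η₃ s (suc (suc zero)) = refl

module _ {p : ℕ} (p-prime : Prime p) (2<p : 2 < p) {X : Fin 3 → ℤ} where

  private
    X₀ = X zero
    X₁ = X (suc zero)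
    X₂ = X (suc (suc zero))
    1≉0 : ¬ 1ℤ ≋ 0ℤ [mod p ]
    1≉0 = small≉0 (s≤s z≤n) (ℕP.<-trans (s≤s (s≤s z≤n)) 2<p)

  unitZeroSum-01 : ¬ X₀ ≋ 0ℤ [mod p ] → ¬ X₁ ≋ 0ℤ [mod p ] → UnitZeroSum p (true ∷ true ∷ false ∷ []) X
  unitZeroSum-01 X₀≉0 X₁≉0 = weighted (X₁ ∷ - X₀ ∷ 1ℤ ∷ [])
    (λ { zero → X₁≉0 ; (suc zero) → -‿≉0 X₀≉0 ; (suc (suc zero)) → 1≉0 })
    (≋-reflexive (cancel X₀ X₁))
    where
    cancel : ∀ a b → b · a + (- a · b + 0ℤ) ≡ 0ℤ
    cancel = solve-∀

  unitZeroSum-02 : ¬ X₀ ≋ 0ℤ [mod p ] → ¬ X₂ ≋ 0ℤ [mod p ] → UnitZeroSum p (true ∷ false ∷ true ∷ []) X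
  unitZeroSum-02 X₀≉0 X₂≉0 = weighted (X₂ ∷ 1ℤ ∷ - X₀ ∷ [])
    (λ { zero → X₂≉0 ; (suc zero) → 1≉0 ; (suc (suc zero)) → -‿≉0 X₀≉0 })
    (≋-reflexive (cancel X₀ X₂))
    where
    cancel : ∀ a b → b · a + (0ℤ + (- a · b + 0ℤ)) ≡ 0ℤ
    cancel = solve-∀

  unitZeroSum-012 : ¬ X₀ ≋ 0ℤ [mod p ] → ¬ X₁ ≋ 0ℤ [mod p ] → ¬ X₂ ≋ 0ℤ [mod p ] →
    UnitZeroSum p (λ _ → true) X
  unitZeroSum-012 X₀≉0 X₁≉0 X₂≉0 = weighted (X₁ · X₂ ∷ X₀ · X₂ ∷ - + 2 · (X₀ · X₁) ∷ [])
    (λ { zero → ·-≉0 p-prime X₁≉0 X₂≉0 ; (suc zero) → ·-≉0 p-prime X₀≉0 X₂≉0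
       ; (suc (suc zero)) → ·-≉0 p-prime (-‿≉0 (small≉0 (s≤s z≤n) 2<p)) (·-≉0 p-prime X₀≉0 X₁≉0) })
    (≋-reflexive (cancel X₀ X₁ X₂))
    where
    cancel : ∀ a b c → b · c · a + (a · c · b + (- + 2 · (a · b) · c + 0ℤ)) ≡ 0ℤ
    cancel = solve-∀

  unitZeroSum-full : ¬ X₀ ≋ 0ℤ [mod p ] → ¬ (X₁ ≋ 0ℤ [mod p ] × X₂ ≋ 0ℤ [mod p ]) →
    UnitZeroSum p (λ _ → true) X
  unitZeroSum-full X₀≉0 ¬both = cases (≋0? X₁) (≋0? X₂)
    where
    cases : Dec (X₁ ≋ 0ℤ [mod p ]) → Dec (X₂ ≋ 0ℤ [mod p ]) → UnitZeroSum p (λ _ → true) X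
    cases (yes X₁≋0) (yes X₂≋0) = contradiction (X₁≋0 , X₂≋0) ¬both
    cases (yes X₁≋0) (no  X₂≉0) = weightedZeroSum-complete (unitZeroSum-02 X₀≉0 X₂≉0)
                                    λ { zero () ; (suc zero) _ → X₁≋0 ; (suc (suc zero)) () }
    cases (no  X₁≉0) (yes X₂≋0) = weightedZeroSum-complete (unitZeroSum-01 X₀≉0 X₁≉0)
                                    λ { zero () ; (suc zero) () ; (suc (suc zero)) _ → X₂≋0 }
    cases (no  X₁≉0) (no  X₂≉0) = unitZeroSum-012 X₀≉0 X₁≉0 X₂≉0


module _ {q : ℕ} (q-prime : Prime q) where

  squareZeroSum-of-QSq : ∀ {l} {w : Fin l → Fin q} {X : Fin l → ℤ} →
    (∀ i → + toℕ (w i) ≋ X i [mod q ]) → HasWZS q (QSq q) w →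
    Σ (Fin l → Bool) λ s → (∃ λ i → s i ≡ true) × SquareZeroSum q s X
  squareZeroSum-of-QSq {w = w} {X} w≋X (s , nonempty , b , b∈Q , q∣Σ) =
    s , nonempty , weighted B B-square (begin
      selectedSum s B X   ≡⟨ selectedSum-on-selection s X B≡b ⟩
      selectedSum s b′ X  ≈⟨ selectedSum-cong s {α = b′} {b′} {X} {W} (λ _ → ≋-refl) (λ i → ≋-sym (w≋X i)) ⟩
      selectedSum s b′ W  ≡⟨ wsum≡selectedSum s b w ⟨
      + wsum s b w        ≈⟨ ℕ∣⇒≋0 q∣Σ ⟩
      0ℤ                  ∎)
    where
    open ≋-Reasoning q
    b′ W B : Fin _ → ℤ
    b′ i = + toℕ (b i)
    W i = + toℕ (w i)
    B i = if s i then b′ i else 1ℤ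
    B≡b : ∀ i → s i ≡ true → B i ≡ b′ i
    B≡b i sᵢ rewrite sᵢ = refl
    B-square : ∀ i → NonzeroSquare q (B i)
    B-square i with s i in sᵢ
    ... | true  = QSq⇒nonzeroSquare q-prime (b∈Q i sᵢ)
    ... | false = nonzeroSquare-1 (prime>1 q-prime)

module _ {q : ℕ} (q-prime : Prime q) (7≤q : 7 ≤ q) {X : Fin 3 → ℤ} (X≉0 : ∀ i → ¬ X i ≋ 0ℤ [mod q ]) where

  private
    instance
      q-nonZero : NonZero q
      q-nonZero = prime⇒nonZero q-prime
    X₀ = X zero
    X₁ = X (suc zero)
    X₂ = X (suc (suc zero))
    square-1 : NonzeroSquare q 1ℤ
    square-1 = nonzeroSquare-1 (prime>1 q-prime)
    single : ∀ {s : Fin 3 → Bool} i → s i ≡ true → (∀ j → s j ≡ true → j ≡ i) → ¬ SquareZeroSum q s X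
    single i sᵢ only zs = X≉0 i (weightedZeroSum-single q-prime (nonzeroSquare-≉0 q-prime) sᵢ only zs)

  squareZeroSum-complete₃ : ∀ c₀ c₁ c₂ → (∃ λ i → (c₀ ∷ c₁ ∷ c₂ ∷ []) i ≡ true) →
    SquareZeroSum q (c₀ ∷ c₁ ∷ c₂ ∷ []) X → SquareZeroSum q (λ _ → true) X
  squareZeroSum-complete₃ false false false (zero , ())
  squareZeroSum-complete₃ false false false (suc zero , ())
  squareZeroSum-complete₃ false false false (suc (suc zero) , ())
  squareZeroSum-complete₃ true  false false _ zs =
    contradiction zs (single zero refl λ { zero _ → refl ; (suc zero) () ; (suc (suc zero)) () })
  squareZeroSum-complete₃ false true  false _ zs =
    contradiction zs (single (suc zero) refl λ { zero () ; (suc zero) _ → refl ; (suc (suc zero)) () })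
  squareZeroSum-complete₃ false false true  _ zs =
    contradiction zs (single (suc (suc zero)) refl λ { zero () ; (suc zero) () ; (suc (suc zero)) _ → refl })
  squareZeroSum-complete₃ true  true  true  _ zs =
    weightedZeroSum-≗ (λ { zero → refl ; (suc zero) → refl ; (suc (suc zero)) → refl }) zs
  squareZeroSum-complete₃ true  true  false _ (weighted β β-square Σ≋0) =
    completion (squareWeights-absorb q-prime 7≤q (β-square zero) (β-square (suc zero)) (X≉0 zero)
      (≋-trans (≋-reflexive (regroup₀ (β zero · X₀) (β (suc zero) · X₁))) Σ≋0) X₂)
    where
    regroup₀ : ∀ a b → a + b ≡ a + (b + 0ℤ)
    regroup₀ = solve-∀
    regroup : ∀ a b A B C → a · A + (b · B + (1ℤ · C + 0ℤ)) ≡ a · A + b · B + C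
    regroup = solve-∀
    completion : SquareCombination q X₀ X₁ X₂ → SquareZeroSum q (λ _ → true) X
    completion (γ₀ , γ₁ , γ₀-square , γ₁-square , Σ′≋0) =
      weighted (γ₀ ∷ γ₁ ∷ 1ℤ ∷ []) (λ { zero → γ₀-square ; (suc zero) → γ₁-square ; (suc (suc zero)) → square-1 })
        (≋-trans (≋-reflexive (regroup γ₀ γ₁ X₀ X₁ X₂)) Σ′≋0)
  squareZeroSum-complete₃ true  false true  _ (weighted β β-square Σ≋0) =
    completion (squareWeights-absorb q-prime 7≤q (β-square zero) (β-square (suc (suc zero))) (X≉0 zero)
      (≋-trans (≋-reflexive (regroup₀ (β zero · X₀) (β (suc (suc zero)) · X₂))) Σ≋0) X₁)
    where
    regroup₀ : ∀ a b → a + b ≡ a + (0ℤ + (b + 0ℤ))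
    regroup₀ = solve-∀
    regroup : ∀ a b A B C → a · A + (1ℤ · C + (b · B + 0ℤ)) ≡ a · A + b · B + C
    regroup = solve-∀
    completion : SquareCombination q X₀ X₂ X₁ → SquareZeroSum q (λ _ → true) X
    completion (γ₀ , γ₂ , γ₀-square , γ₂-square , Σ′≋0) =
      weighted (γ₀ ∷ 1ℤ ∷ γ₂ ∷ []) (λ { zero → γ₀-square ; (suc zero) → square-1 ; (suc (suc zero)) → γ₂-square })
        (≋-trans (≋-reflexive (regroup γ₀ γ₂ X₀ X₂ X₁)) Σ′≋0)
  squareZeroSum-complete₃ false true  true  _ (weighted β β-square Σ≋0) =
    completion (squareWeights-absorb q-prime 7≤q (β-square (suc zero)) (β-square (suc (suc zero))) (X≉0 (suc zero))
      (≋-trans (≋-reflexive (regroup₀ (β (suc zero) · X₁) (β (suc (suc zero)) · X₂))) Σ≋0) X₀)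
    where
    regroup₀ : ∀ a b → a + b ≡ 0ℤ + (a + (b + 0ℤ))
    regroup₀ = solve-∀
    regroup : ∀ a b A B C → 1ℤ · C + (a · A + (b · B + 0ℤ)) ≡ a · A + b · B + C
    regroup = solve-∀
    completion : SquareCombination q X₁ X₂ X₀ → SquareZeroSum q (λ _ → true) X
    completion (γ₁ , γ₂ , γ₁-square , γ₂-square , Σ′≋0) =
      weighted (1ℤ ∷ γ₁ ∷ γ₂ ∷ []) (λ { zero → square-1 ; (suc zero) → γ₁-square ; (suc (suc zero)) → γ₂-square })
        (≋-trans (≋-reflexive (regroup γ₁ γ₂ X₁ X₂ X₀)) Σ′≋0)

  squareZeroSum-full : DavProp q (QSq q) 3 → SquareZeroSum q (λ _ → true) X
  squareZeroSum-full dav =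
    complete (squareZeroSum-of-QSq q-prime (λ i → residue-≋ q (X i)) (dav (λ i → residue q (X i))))
    where
    complete : (Σ (Fin 3 → Bool) λ s → (∃ λ i → s i ≡ true) × SquareZeroSum q s X) → SquareZeroSum q (λ _ → true) X
    complete (s , (i , sᵢ) , zs) = squareZeroSum-complete₃ (s zero) (s (suc zero)) (s (suc (suc zero)))
      (i , ≡.trans (≡.sym (η₃ s i)) sᵢ) (weightedZeroSum-≗ (η₃ s) zs)

-- The weights L(p q; p)

legendre≡1 : ∀ {a p} → ¬ p ∣ a → QuadraticResidue a p → legendre a p ≡ + 1
legendre≡1 {a} {p} p∤a qr with p ∣? a | QR? a p
... | yes p∣a | _     = contradiction p∣a p∤a
... | no _    | yes _ = refl
... | no _    | no ¬qr = contradiction qr ¬qr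

legendre≡1⇒ : ∀ {a p} → legendre a p ≡ + 1 → ¬ p ∣ a × QuadraticResidue a p
legendre≡1⇒ {a} {p} eq with p ∣? a | QR? a p
legendre≡1⇒ () | yes _ | _
... | no p∤a | yes qr = p∤a , qr
legendre≡1⇒ () | no _ | no _

legendre-nonZero : ∀ {a p} → ¬ p ∣ a → ℤ.NonZero (legendre a p)
legendre-nonZero {a} {p} p∤a with p ∣? a | QR? a p
... | yes p∣a | _     = contradiction p∣a p∤a
... | no _    | yes _ = _
... | no _    | no _  = _

module _ {p q : ℕ} (p-prime : Prime p) (q-prime : Prime q) (p≢q : p ≢ q) where

  private
    n = p * q
    instance
      p-nonZero : NonZero p
      p-nonZero = prime⇒nonZero p-prime
      q-nonZero : NonZero q
      q-nonZero = prime⇒nonZero q-prime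
      n-nonZero : NonZero n
      n-nonZero = ℕP.m*n≢0 p q
    p⊥q : Coprime p q
    p⊥q = primes-coprime p-prime q-prime p≢q
    p≉0 : ¬ + p ≋ 0ℤ [mod q ]
    p≉0 = coprime⇒¬∣ q-prime p⊥q ∘ ≋0⇒ℕ∣
    q≉0 : ¬ + q ≋ 0ℤ [mod p ]
    q≉0 = coprime⇒¬∣ p-prime (Coprimality.sym p⊥q) ∘ ≋0⇒ℕ∣

  L⇒ : ∀ {a} → L p q a → ¬ + toℕ a ≋ 0ℤ [mod p ] × NonzeroSquare q (+ toℕ a)
  L⇒ {a} (a⊥n , jacobi≡legendre) =
    coprime⇒¬∣ p-prime a⊥p ∘ ≋0⇒ℕ∣ , square (legendre≡1⇒ legendre-q≡1)
    where
    a⊥p : Coprime (toℕ a) p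
    a⊥p (d∣a , d∣p) = a⊥n (d∣a , ℕ∣.∣-trans d∣p (ℕ∣.m∣m*n q))
    legendre-q≡1 : legendre (toℕ a) q ≡ + 1
    legendre-q≡1 = ≡.trans (≡.sym (ℤP.*-identityʳ _))
      (ℤP.*-cancelˡ-≡ (legendre (toℕ a) p) _ _ {{legendre-nonZero (coprime⇒¬∣ p-prime a⊥p)}}
        (≡.trans jacobi≡legendre (≡.sym (ℤP.*-identityʳ _))))
    square : ¬ q ∣ toℕ a × QuadraticResidue (toℕ a) q → NonzeroSquare q (+ toℕ a)
    square (q∤a , residue) = quadraticResidue⇒nonzeroSquare q-prime q∤a residue

  L-intro : ∀ {a} → ¬ + toℕ a ≋ 0ℤ [mod p ] → NonzeroSquare q (+ toℕ a) → L p q a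
  L-intro {a} a≉0 a-square =
    coprime-* (¬∣⇒coprime p-prime (a≉0 ∘ ℕ∣⇒≋0)) (¬∣⇒coprime q-prime (nonzeroSquare-≉0 q-prime a-square ∘ ℕ∣⇒≋0)) ,
    ≡.trans (cong (λ k → legendre (toℕ a) p · (k · + 1)) legendre-q≡1) (ℤP.*-identityʳ _)
    where
    root : (Σ (Fin q) λ x → Unit q x × toℕ x * toℕ x ≡ toℕ a [mod q ]) → QuadraticResidue (toℕ a) q
    root (x , _ , x²≡a) = x , x²≡a
    legendre-q≡1 : legendre (toℕ a) q ≡ + 1
    legendre-q≡1 = legendre≡1 (nonzeroSquare-≉0 q-prime a-square ∘ ℕ∣⇒≋0)
      (root (nonzeroSquare⇒root q-prime a-square))

  crt : ∀ α β → Σ (Fin n) λ a → + toℕ a ≋ α [mod p ] × + toℕ a ≋ β [mod q ]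
  crt α β = combine (inverse p-prime q≉0) (inverse q-prime p≉0)
    where
    combine : Inverse p (+ q) → Inverse q (+ p) → Σ (Fin n) λ a → + toℕ a ≋ α [mod p ] × + toℕ a ≋ β [mod q ]
    combine (u , uq≋1) (v , vp≋1) = a , a≋α , a≋β
      where
      c = α · (u · + q) + β · (v · + p)
      a = residue n c
      simplify : ∀ α β v → α · 1ℤ + β · (v · 0ℤ) ≡ α
      simplify = solve-∀
      simplify′ : ∀ α β u → α · (u · 0ℤ) + β · 1ℤ ≡ β
      simplify′ = solve-∀
      a≋α : + toℕ a ≋ α [mod p ]
      a≋α = begin
        + toℕ a                ≈⟨ ≋-weaken (ℕ∣.m∣m*n q) (residue-≋ n c) ⟩
        c                      ≈⟨ +-cong (·-cong (≋-refl {i = α}) uq≋1)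
                                         (·-cong (≋-refl {i = β}) (·-cong (≋-refl {i = v}) (ℕ∣⇒≋0 ℕ∣.∣-refl))) ⟩
        α · 1ℤ + β · (v · 0ℤ)  ≡⟨ simplify α β v ⟩
        α                      ∎
        where open ≋-Reasoning p
      a≋β : + toℕ a ≋ β [mod q ]
      a≋β = begin
        + toℕ a                ≈⟨ ≋-weaken (ℕ∣.n∣m*n p) (residue-≋ n c) ⟩
        c                      ≈⟨ +-cong (·-cong (≋-refl {i = α}) (·-cong (≋-refl {i = u}) (ℕ∣⇒≋0 ℕ∣.∣-refl)))
                                         (·-cong (≋-refl {i = β}) vp≋1) ⟩
        α · (u · 0ℤ) + β · 1ℤ  ≡⟨ simplify′ α β u ⟩
        β                      ∎
        where open ≋-Reasoning q

  L-weight : ∀ {α β} → ¬ α ≋ 0ℤ [mod p ] → NonzeroSquare q β →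
    Σ (Fin n) λ a → L p q a × + toℕ a ≋ α [mod p ] × + toℕ a ≋ β [mod q ]
  L-weight {α} {β} α≉0 β-square = weight (crt α β)
    where
    weight : (Σ (Fin n) λ a → + toℕ a ≋ α [mod p ] × + toℕ a ≋ β [mod q ]) →
      Σ (Fin n) λ a → L p q a × + toℕ a ≋ α [mod p ] × + toℕ a ≋ β [mod q ]
    weight (a , a≋α , a≋β) = a , L-intro (≋-≉0 a≋α α≉0) (nonzeroSquare-≋ (≋-sym a≋β) β-square) , a≋α , a≋β

  L-one : Σ (Fin n) λ one → L p q one × + toℕ one ≋ 1ℤ [mod n ]
  L-one = one (L-weight (small≉0 (s≤s z≤n) (prime>1 p-prime))
                        (nonzeroSquare-1 (prime>1 q-prime)))
    where
    one : (Σ (Fin n) λ a → L p q a × + toℕ a ≋ 1ℤ [mod p ] × + toℕ a ≋ 1ℤ [mod q ]) →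
      Σ (Fin n) λ one → L p q one × + toℕ one ≋ 1ℤ [mod n ]
    one (a , a∈L , a≋1 , a≋1′) = a , a∈L , ≋-combine p⊥q a≋1 a≋1′

  L-equiv-permute : ∀ {l} (x : Fin l → Fin n) (π : Permutation′ l) → Equiv n (L p q) x (x ∘ (π ⟨$⟩ʳ_))
  L-equiv-permute x π = equiv L-one
    where
    equiv : (Σ (Fin n) λ one → L p q one × + toℕ one ≋ 1ℤ [mod n ]) → Equiv n (L p q) x (x ∘ (π ⟨$⟩ʳ_))
    equiv (one , one∈L , one≋1) = Equiv-permute one one∈L (proj₁ one∈L) one≋1 x π

  zeroSum-of-local : ∀ {l} (x : Fin l → Fin n) (s : Fin l → Bool) → (∃ λ i → s i ≡ true) →
    UnitZeroSum p s (λ i → + toℕ (x i)) → SquareZeroSum q s (λ i → + toℕ (x i)) → HasWZS n (L p q) x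
  zeroSum-of-local x s nonempty (weighted α α≉0 Σα≋0) (weighted β β-square Σβ≋0) =
    s , nonempty , a , (λ i _ → proj₁ (proj₂ (weight i))) ,
    ≋0⇒ℕ∣ (≋-combine p⊥q (Σa≋0 (λ i → proj₁ (proj₂ (proj₂ (weight i)))) Σα≋0)
                          (Σa≋0 (λ i → proj₂ (proj₂ (proj₂ (weight i)))) Σβ≋0))
    where
    weight : ∀ i → Σ (Fin n) λ a → L p q a × + toℕ a ≋ α i [mod p ] × + toℕ a ≋ β i [mod q ]
    weight i = L-weight (α≉0 i) (β-square i)
    a : Fin _ → Fin n
    a i = proj₁ (weight i)
    Σa≋0 : ∀ {d} {γ : Fin _ → ℤ} → (∀ i → + toℕ (a i) ≋ γ i [mod d ]) →
      selectedSum s γ (λ i → + toℕ (x i)) ≋ 0ℤ [mod d ] → + wsum s a x ≋ 0ℤ [mod d ]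
    Σa≋0 a≋γ Σγ≋0 = ≋-trans (≋-reflexive (wsum≡selectedSum s a x)) (≋-trans (selectedSum-cong s a≋γ (λ _ → ≋-refl)) Σγ≋0)

  private
    lift : ∀ {k} → (Fin k → Fin q) → Fin (ℕ.suc k) → Fin n
    lift w = residue n (+ q) ∷ λ j → residue n (+ p · + toℕ (w j))

    lift-tail≋ : ∀ {k d} (w : Fin k → Fin q) → d ∣ n → ∀ j → + toℕ (lift w (suc j)) ≋ + p · + toℕ (w j) [mod d ]
    lift-tail≋ w d∣n j = ≋-weaken d∣n (residue-≋ n (+ p · + toℕ (w j)))

    lift-sum≋0 : ∀ {k d} (w : Fin k → Fin q) {s a} → n ∣ wsum s a (lift w) → d ∣ n →
      (if s zero then + toℕ (a zero) · + toℕ (lift w zero) else 0ℤ) +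
      selectedSum (s ∘ suc) (λ j → + toℕ (a (suc j))) (λ j → + toℕ (lift w (suc j))) ≋ 0ℤ [mod d ]
    lift-sum≋0 w {s} {a} n∣Σ d∣n = ≋-weaken d∣n (≋-trans (≋-reflexive (≡.sym (wsum≡selectedSum s a (lift w)))) (ℕ∣⇒≋0 n∣Σ))

  lift-head-unselected : ∀ {k} (w : Fin k → Fin q) {s a} → (∀ i → s i ≡ true → L p q (a i)) →
    n ∣ wsum s a (lift w) → s zero ≡ false
  lift-head-unselected w {s} {a} a∈L n∣Σ = head (s zero) refl
    where
    T = selectedSum (s ∘ suc) (λ j → + toℕ (a (suc j))) (λ j → + toℕ (lift w (suc j)))
    H : Bool → ℤ
    H b = if b then + toℕ (a zero) · + toℕ (lift w zero) else 0ℤ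
    Y₀≉0 : ¬ + toℕ (lift w zero) ≋ 0ℤ [mod p ]
    Y₀≉0 = ≋-≉0 (≋-weaken (ℕ∣.m∣m*n q) (residue-≋ n (+ q))) q≉0
    T≋0 : T ≋ 0ℤ [mod p ]
    T≋0 = selectedSum-≋0 (s ∘ suc) (λ j → + toℕ (a (suc j))) λ j _ →
      ≋-trans (lift-tail≋ w (ℕ∣.m∣m*n q) j) (·-cong (ℕ∣⇒≋0 ℕ∣.∣-refl) (≋-refl {i = + toℕ (w j)}))
    isolate : ∀ a t → a ≡ (a + t) + - t
    isolate = solve-∀
    head≋0 : s zero ≡ true → + toℕ (a zero) · + toℕ (lift w zero) ≋ 0ℤ [mod p ]
    head≋0 s₀ = ≋-trans (≋-reflexive (isolate _ T))
      (+-cong (≋-trans (≋-reflexive (cong (λ b → H b + T) (≡.sym s₀))) (lift-sum≋0 w {s} {a} n∣Σ (ℕ∣.m∣m*n q)))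
              (-‿cong T≋0))
    head : ∀ b → s zero ≡ b → s zero ≡ false
    head false s₀ = s₀
    head true  s₀ = contradiction (head≋0 s₀) (·-≉0 p-prime (proj₁ (L⇒ (a∈L zero s₀))) Y₀≉0)

  zeroSum-of-lift : ∀ {k} (w : Fin k → Fin q) → HasWZS n (L p q) (lift w) → HasWZS q (QSq q) w
  zeroSum-of-lift {k} w (s , (i , sᵢ) , a , a∈L , n∣Σ) =
    s ∘ suc , tail-nonempty i sᵢ , b , b∈QSq , ≋0⇒ℕ∣ (begin
      + wsum (s ∘ suc) b w       ≡⟨ wsum≡selectedSum (s ∘ suc) b w ⟩
      selectedSum (s ∘ suc) B W  ≈⟨ selectedSum-cong (s ∘ suc) {X = W} (λ j → residue-≋ q (A j)) (λ _ → ≋-refl) ⟩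
      selectedSum (s ∘ suc) A W  ≈⟨ [ (λ p≋0 → contradiction p≋0 p≉0) , (λ Σ≋0 → Σ≋0) ]′ (≋0-·⁻ q-prime pΣ≋0) ⟩
      0ℤ                         ∎)
    where
    open ≋-Reasoning q
    s₀ : s zero ≡ false
    s₀ = lift-head-unselected w {s} {a} a∈L n∣Σ
    tail-nonempty : ∀ i → s i ≡ true → ∃ λ j → s (suc j) ≡ true
    tail-nonempty zero    s₀′ = contradiction (≡.trans (≡.sym s₀) s₀′) λ ()
    tail-nonempty (suc j) sⱼ  = j , sⱼ
    A W B : Fin k → ℤ
    A j = + toℕ (a (suc j))
    W j = + toℕ (w j)
    B j = + toℕ (residue q (A j))
    b : Fin k → Fin q
    b j = residue q (A j)
    T = selectedSum (s ∘ suc) A (λ j → + toℕ (lift w (suc j)))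
    H : Bool → ℤ
    H b = if b then + toℕ (a zero) · + toℕ (lift w zero) else 0ℤ
    b∈QSq : ∀ j → s (suc j) ≡ true → QSq q (b j)
    b∈QSq j sⱼ = nonzeroSquare⇒QSq q-prime (proj₂ (L⇒ (a∈L (suc j) sⱼ)))
    pΣ≋0 : + p · selectedSum (s ∘ suc) A W ≋ 0ℤ [mod q ]
    pΣ≋0 = begin
      + p · selectedSum (s ∘ suc) A W            ≡⟨ selectedSum-scale (s ∘ suc) A W (+ p) ⟨
      selectedSum (s ∘ suc) A (λ j → + p · W j)  ≈⟨ selectedSum-cong (s ∘ suc) {α = A} (λ _ → ≋-refl) (λ j → ≋-sym (lift-tail≋ w (ℕ∣.n∣m*n p) j)) ⟩
      T                                          ≡⟨ ℤP.+-identityˡ T ⟨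
      H false + T                                ≡⟨ cong (λ b → H b + T) s₀ ⟨
      H (s zero) + T                             ≈⟨ lift-sum≋0 w {s} {a} n∣Σ (ℕ∣.n∣m*n p) ⟩
      0ℤ                                         ∎

  -- A zero-sum-free w lifts to the zero-sum-free sequence (q, p w₁, …, p wₖ) of length k + 1.
  DavProp-L⇒DavProp-QSq : ∀ {k} → DavProp n (L p q) (ℕ.suc k) → DavProp q (QSq q) k
  DavProp-L⇒DavProp-QSq dav w = zeroSum-of-lift w (dav (lift w))

-- Sequences of length three

module _ {p q : ℕ} (p-prime : Prime p) (q-prime : Prime q) (p≢q : p ≢ q) (7≤p : 7 ≤ p) (7≤q : 7 ≤ q)
         (davenport-q : DavProp q (QSq q) 3) where

  private
    n = p * q
    instance
      q-nonZero : NonZero q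
      q-nonZero = prime⇒nonZero q-prime
    2<p : 2 < p
    2<p = ℕP.<-≤-trans (ℕP.n<1+n 2) (ℕP.≤-trans (ℕP.m≤n+m 3 4) 7≤p)
    unit-1 : ¬ 1ℤ ≋ 0ℤ [mod p ]
    unit-1 = small≉0 (s≤s z≤n) (ℕP.<-trans (ℕP.n<1+n 1) 2<p)
    square-1 : NonzeroSquare q 1ℤ
    square-1 = nonzeroSquare-1 (prime>1 q-prime)

  TailExtremal : (Fin 3 → Fin n) → Set
  TailExtremal y = Σ (Fin 2 → Fin q) λ z → ImageMod q (λ i → y (suc i)) z × Extremal q (QSq q) z

  CaseI : (Fin 3 → Fin n) → Set
  CaseI y = q ∣ toℕ (y zero) × ¬ q ∣ toℕ (y (suc zero)) × ¬ q ∣ toℕ (y (suc (suc zero))) ×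
            toℕ (y zero) ≢ 0 × TailExtremal y

  CaseII : (Fin 3 → Fin n) → Set
  CaseII y = Coprime (toℕ (y zero)) p × ¬ Coprime (toℕ (y (suc zero))) p ×
             ¬ Coprime (toℕ (y (suc (suc zero)))) p × TailExtremal y

  module _ (y : Fin 3 → Fin n) (y-free : ¬ HasWZS n (L p q) y) where

    private
      Y : Fin 3 → ℤ
      Y i = + toℕ (y i)

    no-local-zeroSum : ∀ {s} → (∃ λ i → s i ≡ true) → ¬ (UnitZeroSum p s Y × SquareZeroSum q s Y)
    no-local-zeroSum nonempty (unit , square) = y-free (zeroSum-of-local p-prime q-prime p≢q y _ nonempty unit square)

    not-divisible-by-both : ∀ i → Y i ≋ 0ℤ [mod p ] → ¬ Y i ≋ 0ℤ [mod q ]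
    not-divisible-by-both i Yᵢ≋0 Yᵢ≋0′ = no-local-zeroSum {s = λ j → does (j Fin.≟ i)} (i , Dec.dec-true (i Fin.≟ i) refl)
      (weightedZeroSum-divisible unit-1 (λ j sⱼ → ≡.subst (λ k → Y k ≋ 0ℤ [mod p ]) (selected sⱼ) Yᵢ≋0) ,
       weightedZeroSum-divisible square-1 (λ j sⱼ → ≡.subst (λ k → Y k ≋ 0ℤ [mod q ]) (selected sⱼ) Yᵢ≋0′))
      where
      selected : ∀ {j} → does (j Fin.≟ i) ≡ true → i ≡ j
      selected {j} sⱼ with j Fin.≟ i
      ... | yes refl = refl
      ... | no _ with () ← sⱼ

    private
      tail : Fin 2 → Fin q
      tail i = residue q (Y (suc i))

      tail-extremal : ¬ HasWZS q (QSq q) tail → TailExtremal y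
      tail-extremal tail-free =
        tail , (λ i → ≋⇒≡-mod (residue-≋ q (Y (suc i)))) , free⇒extremal {A = QSq q} {x = tail} davenport-q tail-free

      tail-squareZeroSum : HasWZS q (QSq q) tail →
        Σ (Fin 2 → Bool) λ s → (∃ λ i → s i ≡ true) × SquareZeroSum q (false ∷ s) Y
      tail-squareZeroSum zs = prepend (squareZeroSum-of-QSq q-prime {X = Y ∘ suc} (λ i → residue-≋ q (Y (suc i))) zs)
        where
        prepend : (Σ (Fin 2 → Bool) λ s → (∃ λ i → s i ≡ true) × SquareZeroSum q s (Y ∘ suc)) →
          Σ (Fin 2 → Bool) λ s → (∃ λ i → s i ≡ true) × SquareZeroSum q (false ∷ s) Y
        prepend (s , nonempty , square) = s , nonempty , weightedZeroSum-prepend square-1 square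

    caseII : ¬ Y zero ≋ 0ℤ [mod p ] → Y (suc zero) ≋ 0ℤ [mod p ] → Y (suc (suc zero)) ≋ 0ℤ [mod p ] → CaseII y
    caseII Y₀≉0 Y₁≋0 Y₂≋0 =
      ¬∣⇒coprime p-prime (Y₀≉0 ∘ ℕ∣⇒≋0) , (λ c → coprime⇒¬∣ p-prime c (≋0⇒ℕ∣ Y₁≋0)) ,
      (λ c → coprime⇒¬∣ p-prime c (≋0⇒ℕ∣ Y₂≋0)) , tail-extremal tail-free
      where
      tail-free : ¬ HasWZS q (QSq q) tail
      tail-free = lifted ∘ tail-squareZeroSum
        where
        lifted : ¬ (Σ (Fin 2 → Bool) λ s → (∃ λ i → s i ≡ true) × SquareZeroSum q (false ∷ s) Y)
        lifted (s , (i , sᵢ) , square) = no-local-zeroSum (suc i , sᵢ)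
          (weightedZeroSum-divisible unit-1 (λ { zero () ; (suc zero) _ → Y₁≋0 ; (suc (suc zero)) _ → Y₂≋0 }) , square)

    caseI : Y zero ≋ 0ℤ [mod q ] → ¬ (Y (suc zero) ≋ 0ℤ [mod p ] × Y (suc (suc zero)) ≋ 0ℤ [mod p ]) → CaseI y
    caseI Y₀≋0 ¬both =
      ≋0⇒ℕ∣ Y₀≋0 , Y₁≉0 ∘ ℕ∣⇒≋0 , Y₂≉0 ∘ ℕ∣⇒≋0 , (λ y₀≡0 → Y₀≉0 (≋-reflexive (cong +_ y₀≡0))) ,
      tail-extremal (lifted ∘ tail-squareZeroSum)
      where
      Y₀≉0 : ¬ Y zero ≋ 0ℤ [mod p ]
      Y₀≉0 Y₀≋0′ = not-divisible-by-both zero Y₀≋0′ Y₀≋0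
      Y₁≉0 : ¬ Y (suc zero) ≋ 0ℤ [mod q ]
      Y₁≉0 Y₁≋0 = [ (λ Y₁≋0′ → not-divisible-by-both (suc zero) Y₁≋0′ Y₁≋0) ,
                    (λ Y₁≉0′ → no-local-zeroSum (zero , refl) (unitZeroSum-01 p-prime 2<p Y₀≉0 Y₁≉0′ ,
                      weightedZeroSum-divisible square-1 λ { zero _ → Y₀≋0 ; (suc zero) _ → Y₁≋0 ; (suc (suc zero)) () })) ]′
                  (Dec.toSum (≋0? (Y (suc zero))))
      Y₂≉0 : ¬ Y (suc (suc zero)) ≋ 0ℤ [mod q ]
      Y₂≉0 Y₂≋0 = [ (λ Y₂≋0′ → not-divisible-by-both (suc (suc zero)) Y₂≋0′ Y₂≋0) ,
                    (λ Y₂≉0′ → no-local-zeroSum (zero , refl) (unitZeroSum-02 p-prime 2<p Y₀≉0 Y₂≉0′ ,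
                      weightedZeroSum-divisible square-1 λ { zero _ → Y₀≋0 ; (suc zero) () ; (suc (suc zero)) _ → Y₂≋0 })) ]′
                  (Dec.toSum (≋0? (Y (suc (suc zero)))))
      pair : ∀ c₁ c₂ → (∃ λ i → (false ∷ c₁ ∷ c₂ ∷ []) i ≡ true) → ¬ SquareZeroSum q (false ∷ c₁ ∷ c₂ ∷ []) Y
      pair false false (zero , ())
      pair false false (suc zero , ())
      pair false false (suc (suc zero) , ())
      pair true  false _ square = Y₁≉0 (weightedZeroSum-single q-prime (nonzeroSquare-≉0 q-prime) refl
        (λ { zero () ; (suc zero) _ → refl ; (suc (suc zero)) () }) square)
      pair false true  _ square = Y₂≉0 (weightedZeroSum-single q-prime (nonzeroSquare-≉0 q-prime) refl
        (λ { zero () ; (suc zero) () ; (suc (suc zero)) _ → refl }) square)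
      pair true  true  _ square = no-local-zeroSum (zero , refl) (unitZeroSum-full p-prime 2<p Y₀≉0 ¬both ,
        weightedZeroSum-complete square λ { zero _ → Y₀≋0 ; (suc zero) () ; (suc (suc zero)) () })
      lifted : ¬ (Σ (Fin 2 → Bool) λ s → (∃ λ i → s i ≡ true) × SquareZeroSum q (false ∷ s) Y)
      lifted (s , (i , sᵢ) , square) = pair (s zero) (s (suc zero))
        (suc i , ≡.trans (≡.sym (η₃ (false ∷ s) (suc i))) sᵢ) (weightedZeroSum-≗ (η₃ (false ∷ s)) square)

    classify-q∣ : Y zero ≋ 0ℤ [mod q ] → CaseI y ⊎ CaseII y
    classify-q∣ Y₀≋0 =
      [ (λ (Y₁≋0 , Y₂≋0) → inj₂ (caseII (λ Y₀≋0′ → not-divisible-by-both zero Y₀≋0′ Y₀≋0) Y₁≋0 Y₂≋0)) ,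
        inj₁ ∘ caseI Y₀≋0 ]′
      (Dec.toSum (≋0? (Y (suc zero)) Dec.×-dec ≋0? (Y (suc (suc zero)))))

    classify-q∤ : (∀ i → ¬ Y i ≋ 0ℤ [mod q ]) → ¬ Y zero ≋ 0ℤ [mod p ] → CaseII y
    classify-q∤ Y≉0 Y₀≉0 = caseII Y₀≉0 (proj₁ both) (proj₂ both)
      where
      both : Y (suc zero) ≋ 0ℤ [mod p ] × Y (suc (suc zero)) ≋ 0ℤ [mod p ]
      both = Dec.decidable-stable (≋0? (Y (suc zero)) Dec.×-dec ≋0? (Y (suc (suc zero)))) λ ¬both →
        no-local-zeroSum (zero , refl) (unitZeroSum-full p-prime 2<p Y₀≉0 ¬both , squareZeroSum-full q-prime 7≤q Y≉0 davenport-q)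

    some-unit-mod-p : (∀ i → ¬ Y i ≋ 0ℤ [mod q ]) → ∃ λ i → ¬ Y i ≋ 0ℤ [mod p ]
    some-unit-mod-p Y≉0 = Dec.decidable-stable (any? λ i → Dec.¬? (≋0? (Y i))) λ none →
      no-local-zeroSum (zero , refl)
        (weightedZeroSum-divisible unit-1 (λ i _ → Dec.decidable-stable (≋0? (Y i)) λ Yᵢ≉0 → none (i , Yᵢ≉0)) ,
         squareZeroSum-full q-prime 7≤q Y≉0 davenport-q)

  Classified : (Fin 3 → Fin n) → Set
  Classified x = Σ (Fin 3 → Fin n) λ y → Equiv n (L p q) x y × (CaseI y ⊎ CaseII y)

  classify : (x : Fin 3 → Fin n) → ¬ HasWZS n (L p q) x → Classified x
  classify x x-free = [ divisible-by-q , units-mod-q ]′ (Dec.toSum (any? λ i → ≋0? (X i)))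
    where
    X : Fin 3 → ℤ
    X i = + toℕ (x i)
    front : Fin 3 → Permutation′ 3
    front i = Perm.transpose zero i
    moved : Fin 3 → Fin 3 → Fin n
    moved i = x ∘ (front i ⟨$⟩ʳ_)
    equiv : ∀ i → Equiv n (L p q) x (moved i)
    equiv i = L-equiv-permute p-prime q-prime p≢q x (front i)
    moved-free : ∀ i → ¬ HasWZS n (L p q) (moved i)
    moved-free i = x-free ∘ HasWZS-permute {A = L p q} {x = x} (front i)
    divisible-by-q : (∃ λ i → X i ≋ 0ℤ [mod q ]) → Classified x
    divisible-by-q (i , Xᵢ≋0) = moved i , equiv i , classify-q∣ (moved i) (moved-free i) Xᵢ≋0
    units-mod-q : ¬ (∃ λ i → X i ≋ 0ℤ [mod q ]) → Classified x
    units-mod-q none = let (i , Xᵢ≉0) = some-unit-mod-p x x-free (λ i Xᵢ≋0 → none (i , Xᵢ≋0)) in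
      moved i , equiv i , inj₂ (classify-q∤ (moved i) (moved-free i) (λ j Y≋0 → none (front i ⟨$⟩ʳ j , Y≋0)) Xᵢ≉0)

theorem5p5 : (p' q : ℕ) → Prime p' → Prime q → p' ≢ q → 7 ≤ p' → 7 ≤ q →
    (x : Fin 3 → Fin (p' * q)) → Extremal (p' * q) (L p' q) x →
    Σ (Fin 3 → Fin (p' * q)) λ y → Equiv (p' * q) (L p' q) x y ×
      ((q ∣ toℕ (y zero) × ¬ q ∣ toℕ (y (suc zero)) × ¬ q ∣ toℕ (y (suc (suc zero))) ×
        toℕ (y zero) ≢ 0 ×
        Σ (Fin 2 → Fin q) λ z → ImageMod q (λ i → y (suc i)) z × Extremal q (QSq q) z)
      ⊎
       (Coprime (toℕ (y zero)) p' × ¬ Coprime (toℕ (y (suc zero))) p' ×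
        ¬ Coprime (toℕ (y (suc (suc zero)))) p' ×
        Σ (Fin 2 → Fin q) λ z → ImageMod q (λ i → y (suc i)) z × Extremal q (QSq q) z))
theorem5p5 p' q p'-prime q-prime p'≢q 7≤p' 7≤q x ((k , (davenport , _) , 4≡k) , x-free) =
  classify p'-prime q-prime p'≢q 7≤p' 7≤q davenport-q x x-free
  where
  davenport-q : DavProp q (QSq q) 3
  davenport-q = DavProp-L⇒DavProp-QSq p'-prime q-prime p'≢q (≡.subst (DavProp (p' * q) (L p' q)) (≡.sym 4≡k) davenport)
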